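{- For $n>1$, every $n$-cycle in $S_n$ has an $i$-standard consecutive structure for some $1\leq i\leq n-1$, and this structure is uniquely determined.
   Context: An $n$-cycle in $S_n$ is written as $(a_1=1,a_2,\ldots,a_n)$, starting with $1$; "$x$ occurs to the right of $y$" refers to positions in the sequence $a_1,\ldots,a_n$. An $i$-standard consecutive structure on it is a way of writing $\{1,\ldots,n\}$ as $i$ sequences $a_{s1}<a_{s2}<\cdots<a_{sj_s}$ ($1\leq s\leq i$), with $j_1+\cdots+j_i=n$, such that each sequence consists of consecutive integers ($a_{st}=a_{s1}+(t-1)$), $a_{s(t+1)}$ occurs to the right of $a_{st}$ in $(a_1,\ldots,a_n)$ for all $s$ and $1\le t\le j_s-1$, and $i$ is minimal, i.e. no such decomposition into fewer sequences exists. -}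

module Defs where

open import Data.Nat using (ℕ; zero; suc; _+_; _<_; _≤_)
open import Data.Fin using (Fin; toℕ)
import Data.Fin as F
open import Data.Fin.Permutation using (Permutation′; _⟨$⟩ʳ_)
open import Data.List using (List; map; length)
open import Data.Nat.ListAction using (sum)
open import Data.List.Membership.Propositional using (_∈_)
open import Data.Product using (_×_; Σ; ∃; ∃-syntax; proj₂; _,_)
open import Relation.Binary.PropositionalEquality using (_≡_)

-- Convention: S_n acts on Fin n; the element i ∈ {1,…,n} of the paper is
-- the Fin n element with toℕ = i - 1.  We take n = suc k.

iter : ∀ {n} → Permutation′ n → ℕ → Fin n → Fin n
iter σ zero    x = x
iter σ (suc t) x = σ ⟨$⟩ʳ iter σ t x

-- The cycle written starting with 1: a_{t+1} = σ^t(1), as a 0-based value.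
entry : ∀ {k} → Permutation′ (suc k) → ℕ → ℕ
entry σ t = toℕ (iter σ t F.zero)

IsNCycle : ∀ {k} → Permutation′ (suc k) → Set
IsNCycle {k} σ = ∀ p q → p < suc k → q < suc k →
  iter σ p F.zero ≡ iter σ q F.zero → p ≡ q

RightOf : ∀ {k} → Permutation′ (suc k) → ℕ → ℕ → Set
RightOf {k} σ x y = ∃[ p ] ∃[ q ] (p < q × q < suc k × entry σ p ≡ y × entry σ q ≡ x)

-- A block (s , j) is the sequence s, s+1, …, s+j-1 of consecutive values.
Block : Set
Block = ℕ × ℕ

start : Block → ℕ
start (s , _) = s

len : Block → ℕ
len (_ , j) = j


InBlock : ℕ → Block → Set
InBlock v (s , j) = ∃[ t ] (t < j × v ≡ s + t)

IsConsecStructure : ∀ {k} → Permutation′ (suc k) → List Block → Set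
IsConsecStructure {k} σ bs =
    (∀ b → b ∈ bs → 1 ≤ len b)
  × (∀ b → b ∈ bs → start b + len b ≤ suc k)
  × (sum (map len bs) ≡ suc k)
  × (∀ v → v < suc k → ∃[ b ] (b ∈ bs × InBlock v b))
  × (∀ b → b ∈ bs → ∀ t → suc t < len b →
       RightOf σ (start b + suc t) (start b + t))

-- i-standard consecutive structure with i = length bs: i is minimal.
IsStandardStructure : ∀ {k} → Permutation′ (suc k) → List Block → Set
IsStandardStructure σ bs =
  IsConsecStructure σ bs ×
  (∀ bs′ → IsConsecStructure σ bs′ → length bs ≤ length bs′)

module Submission where

-- Proof idea (values 0-based: the cycle lists 0, …, n-1 starting with 0, n = suc k).
-- Call v a *start* if v = 0 or v-1 does not occur to the left of v.  A start
-- never lies strictly inside a block of a consecutive structure, so every start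
-- begins a block and every structure has at least as many blocks as starts.
-- The canonical structure C cuts 0, …, n-1 into maximal runs, one per start; it
-- is a consecutive structure, hence minimal.  In another minimal structure the
-- block starts are, by counting, exactly the starts; each block then runs up to
-- the next start, so it is the corresponding block of C, and counting again gives
-- a permutation of C.  In an n-cycle 1 occurs after 0, so 1 is not a start and C
-- has at most n-1 blocks.

open import Defs
open import Data.Nat using (ℕ; zero; suc; _+_; _≤_; _<_; z≤n; s≤s; s≤s⁻¹; _<?_)
open import Data.Nat.Properties
open import Data.Nat.ListAction using (sum)
open import Data.Bool using (Bool; true; false; not; if_then_else_)
open import Data.Fin using (Fin; toℕ) renaming (zero to fzero; suc to fsuc)
import Data.Fin.Properties as Fin
open import Data.Fin.Permutation using (Permutation′)
open import Data.List using (List; []; _∷_; length; map; _++_; allFin)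
open import Data.List.Properties using (length-map)
open import Data.List.Membership.Propositional using (_∈_)
open import Data.List.Membership.Propositional.Properties using (∈-∃++; ∈-map⁻; ∈-map⁺; ∈-allFin)
open import Data.List.Relation.Binary.Subset.Propositional using (_⊆_)
open import Data.List.Relation.Unary.Any using (here; there)
open import Data.List.Relation.Unary.All using (All)
import Data.List.Relation.Unary.All as All
open import Data.List.Relation.Unary.AllPairs using ([]; _∷_)
open import Data.List.Relation.Unary.Unique.Propositional using (Unique)
import Data.List.Relation.Unary.Unique.Propositional.Properties as Unique
open import Data.List.Relation.Binary.Permutation.Propositional using (_↭_; ↭-sym; ↭-trans; ↭-refl; prep; ↭⇒↭ₛ)
open import Data.List.Relation.Binary.Permutation.Propositional.Properties using (∈-resp-↭; ↭-length; shift)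
import Data.List.Relation.Binary.Permutation.Setoid.Properties as SetoidPerm
open import Data.Product using (_×_; ∃-syntax; _,_)
open import Data.Sum using (_⊎_; inj₁; inj₂)
open import Data.Empty using (⊥; ⊥-elim)
open import Relation.Nullary using (Dec; yes; no; does)
open import Relation.Nullary.Decidable using (map′; _×-dec_; dec-true)
open import Relation.Binary using (tri<; tri≈; tri>)
open import Relation.Binary.PropositionalEquality

module _ {A : Set} where

  extract : ∀ {x : A} {ys} → x ∈ ys → ∃[ zs ] (ys ↭ x ∷ zs)
  extract {x} x∈ys with us , vs , refl ← ∈-∃++ x∈ys = us ++ vs , shift x us vs

  ⊆-extract : ∀ {x : A} {xs ys zs} → All (x ≢_) xs → x ∷ xs ⊆ ys → ys ↭ x ∷ zs → xs ⊆ zs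
  ⊆-extract x∉xs sub ys↭ z∈xs with ∈-resp-↭ ys↭ (sub (there z∈xs))
  ... | here refl    = ⊥-elim (All.lookup x∉xs z∈xs refl)
  ... | there z∈zs = z∈zs

  unique-⊆-length : ∀ {xs ys : List A} → Unique xs → xs ⊆ ys → length xs ≤ length ys
  unique-⊆-length {[]} _ _ = z≤n
  unique-⊆-length {x ∷ xs} (x∉xs ∷ xs-unique) sub
    with zs , ys↭ ← extract (sub (here refl)) =
    ≤-trans (s≤s (unique-⊆-length xs-unique (⊆-extract x∉xs sub ys↭)))
            (≤-reflexive (sym (↭-length ys↭)))

  unique-⊆-↭ : ∀ {xs ys : List A} → Unique xs → xs ⊆ ys → length ys ≤ length xs → ys ↭ xs
  unique-⊆-↭ {[]} {[]} _ _ _ = ↭-refl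
  unique-⊆-↭ {[]} {_ ∷ _} _ _ ()
  unique-⊆-↭ {x ∷ xs} (x∉xs ∷ xs-unique) sub ys≤
    with zs , ys↭ ← extract (sub (here refl)) =
    ↭-trans ys↭ (prep x (unique-⊆-↭ xs-unique (⊆-extract x∉xs sub ys↭)
                           (s≤s⁻¹ (subst (_≤ suc (length xs)) (↭-length ys↭) ys≤))))

  unique-map-injective : ∀ {B : Set} (f : A → B) {xs x y} → Unique (map f xs) →
                         x ∈ xs → y ∈ xs → f x ≡ f y → x ≡ y
  unique-map-injective f _ (here refl) (here refl) _ = refl
  unique-map-injective f (fx∉ ∷ _) (here refl) (there y∈) fx≡fy = ⊥-elim (All.lookup fx∉ (∈-map⁺ f y∈) fx≡fy)
  unique-map-injective f (fy∉ ∷ _) (there x∈) (here refl) fx≡fy = ⊥-elim (All.lookup fy∉ (∈-map⁺ f x∈) (sym fx≡fy))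
  unique-map-injective f (_ ∷ u) (there x∈) (there y∈) fx≡fy = unique-map-injective f u x∈ y∈ fx≡fy

  unique-resp-↭ : ∀ {xs ys : List A} → xs ↭ ys → Unique xs → Unique ys
  unique-resp-↭ xs↭ys = SetoidPerm.Unique-resp-↭ (setoid A) (↭⇒↭ₛ xs↭ys)

in-block : ∀ {s j v} → s ≤ v → v < s + j → InBlock v (s , j)
in-block {s} {j} s≤v v<s+j with t , refl ← m≤n⇒∃[o]m+o≡n s≤v =
  t , +-cancelˡ-< s t j v<s+j , refl

interior-offset : ∀ {s j v} → s < v → v < s + j → ∃[ t ] (suc t < j × v ≡ s + suc t)
interior-offset {s} {j} s<v v<s+j with t , refl ← m≤n⇒∃[o]m+o≡n s<v =
  t , +-cancelˡ-< s (suc t) j (subst (_< s + j) (sym (+-suc s t)) v<s+j) , sym (+-suc s t)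

decided : ∀ {P : Set} (d : Dec P) → not (does d) ≡ false → P
decided (yes p) _ = p
decided (no _)  ()

true-and-false : ∀ {b : Bool} → b ≡ true → b ≡ false → ⊥
true-and-false refl ()

-- An n-cycle passes through every point: p ↦ σ^p(0) is injective on Fin n, hence onto.
cycle-visits-all : ∀ {k} (σ : Permutation′ (suc k)) → IsNCycle σ →
                   ∀ x → ∃[ q ] (q < suc k × iter σ q fzero ≡ x)
cycle-visits-all {k} σ cycle x = position (∈-map⁻ orbit (∈-resp-↭ onto (∈-allFin x)))
  where
  orbit : Fin (suc k) → Fin (suc k)
  orbit p = iter σ (toℕ p) fzero
  orbit-injective : ∀ {p q} → orbit p ≡ orbit q → p ≡ q
  orbit-injective {p} {q} e = Fin.toℕ-injective (cycle (toℕ p) (toℕ q) (Fin.toℕ<n p) (Fin.toℕ<n q) e)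
  onto : allFin (suc k) ↭ map orbit (allFin (suc k))
  onto = unique-⊆-↭ (Unique.map⁺ orbit-injective (Unique.allFin⁺ (suc k))) (λ {z} _ → ∈-allFin z)
                     (≤-reflexive (sym (length-map orbit (allFin (suc k)))))
  position : ∃[ p ] (p ∈ allFin (suc k) × x ≡ orbit p) → ∃[ q ] (q < suc k × iter σ q fzero ≡ x)
  position (p , _ , x≡) = toℕ p , Fin.toℕ<n p , sym x≡

one-right-of-zero : ∀ {k} (σ : Permutation′ (suc (suc k))) → IsNCycle σ → RightOf σ 1 0
one-right-of-zero σ cycle with cycle-visits-all σ cycle (fsuc fzero)
... | zero , _ , ()
... | suc q , q<n , σ^q+1[0]≡1 = 0 , suc q , s≤s z≤n , q<n , refl , cong toℕ σ^q+1[0]≡1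

module Canonical (k : ℕ) (σ : Permutation′ (suc k)) where

  rightOf? : ∀ x y → Dec (RightOf σ x y)
  rightOf? x y = map′ to from
    (anyUpTo? (λ q → anyUpTo? (λ p → (entry σ p ≟ y) ×-dec (entry σ q ≟ x)) q) (suc k))
    where
    to : ∃[ q ] (q < suc k × ∃[ p ] (p < q × (entry σ p ≡ y × entry σ q ≡ x))) → RightOf σ x y
    to (q , q<n , p , p<q , ep , eq) = p , q , p<q , q<n , ep , eq
    from : RightOf σ x y → ∃[ q ] (q < suc k × ∃[ p ] (p < q × (entry σ p ≡ y × entry σ q ≡ x)))
    from (p , q , p<q , q<n , ep , eq) = q , q<n , p , p<q , ep , eq

  -- v + 1 may follow v inside a block exactly when v + 1 occurs to the right of v.
  Linked : ℕ → Set
  Linked v = RightOf σ (suc v) v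

  -- v is a start: no block can contain v together with v - 1.
  isStart : ℕ → Bool
  isStart zero    = true
  isStart (suc v) = not (does (rightOf? (suc v) v))

  nonStart⇒linked : ∀ v → isStart (suc v) ≡ false → Linked v
  nonStart⇒linked v = decided (rightOf? (suc v) v)

  linked⇒nonStart : ∀ v → Linked v → isStart (suc v) ≡ false
  linked⇒nonStart v linked = cong not (dec-true (rightOf? (suc v) v) linked)

  nonStart⇒linked-at : ∀ s t → isStart (s + suc t) ≡ false → RightOf σ (s + suc t) (s + t)
  nonStart⇒linked-at s t rewrite +-suc s t = nonStart⇒linked (s + t)

  linked⇒nonStart-at : ∀ s t → RightOf σ (s + suc t) (s + t) → isStart (s + suc t) ≡ false
  linked⇒nonStart-at s t rewrite +-suc s t = linked⇒nonStart (s + t)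

  NoStartWithin : ℕ → ℕ → Set
  NoStartWithin s j = ∀ t → suc t < j → isStart (s + suc t) ≡ false

  singleton-no-interior : ∀ s → NoStartWithin s 1
  singleton-no-interior s t (s≤s ())

  record IsRun (b : Block) : Set where
    constructor run
    field
      nonempty      : 1 ≤ len b
      atStart       : isStart (start b) ≡ true
      noStartWithin : NoStartWithin (start b) (len b)
      bounded       : start b + len b ≤ suc k
      ends          : start b + len b ≡ suc k ⊎ isStart (start b + len b) ≡ true

  -- A maximal run cannot be extended: it overruns n or swallows the next start.
  run-not-longer : ∀ {s j j′} → IsRun (s , j) → IsRun (s , j′) → j < j′ → ⊥
  run-not-longer {j = zero} (run () _ _ _ _) _ _
  run-not-longer {s} {suc t} {j′} (run _ _ _ _ (inj₁ end≡n)) r′ j<j′ =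
    <-irrefl refl (<-≤-trans (subst (_< s + j′) end≡n (+-monoʳ-< s j<j′)) (IsRun.bounded r′))
  run-not-longer {j = suc t} (run _ _ _ _ (inj₂ end-start)) r′ j<j′ =
    true-and-false end-start (IsRun.noStartWithin r′ t j<j′)

  run-length-unique : ∀ {s j j′} → IsRun (s , j) → IsRun (s , j′) → j ≡ j′
  run-length-unique {j = j} {j′} r r′ with <-cmp j j′
  ... | tri< j<j′ _ _ = ⊥-elim (run-not-longer r r′ j<j′)
  ... | tri≈ _ j≡j′ _ = j≡j′
  ... | tri> _ _ j>j′ = ⊥-elim (run-not-longer r′ r j>j′)

  -- scan f s j lists the maximal runs of the values from s on, where the current
  -- run began at s and has absorbed j values, and f values s + j, … remain to be read.
  scan : ℕ → ℕ → ℕ → List Block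
  scan zero    s j = (s , j) ∷ []
  scan (suc f) s j = if isStart (s + j) then (s , j) ∷ scan f (s + j) 1 else scan f s (suc j)

  -- The invariant s + j + f ≡ n is preserved when a new run is begun or the current one extended.
  budget-split : ∀ f s j → s + j + suc f ≡ suc k → s + j + 1 + f ≡ suc k
  budget-split f s j e = trans (+-assoc (s + j) 1 f) e

  budget-extend : ∀ f s j → s + j + suc f ≡ suc k → s + suc j + f ≡ suc k
  budget-extend f s j e = trans (cong (_+ f) (+-suc s j)) (trans (sym (+-suc (s + j) f)) e)

  scan-runs : ∀ f s j → 1 ≤ j → isStart s ≡ true → NoStartWithin s j → s + j + f ≡ suc k →
              ∀ {b} → b ∈ scan f s j → IsRun b
  scan-runs zero s j j≥1 s-start within e (here refl) = run j≥1 s-start within (≤-reflexive end) (inj₁ end)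
    where end = trans (sym (+-identityʳ (s + j))) e
  scan-runs (suc f) s j j≥1 s-start within e b∈ with isStart (s + j) in next
  scan-runs (suc f) s j j≥1 s-start within e (here refl) | true =
    run j≥1 s-start within (subst (s + j ≤_) e (m≤m+n (s + j) (suc f))) (inj₂ next)
  scan-runs (suc f) s j j≥1 s-start within e (there b∈) | true =
    scan-runs f (s + j) 1 (s≤s z≤n) next (singleton-no-interior (s + j)) (budget-split f s j e) b∈
  scan-runs (suc f) s j j≥1 s-start within e b∈ | false =
    scan-runs f s (suc j) (s≤s z≤n) s-start within′ (budget-extend f s j e) b∈
    where
    within′ : NoStartWithin s (suc j)
    within′ t t<j+1 with m<1+n⇒m<n∨m≡n t<j+1
    ... | inj₁ t<j = within t t<j
    ... | inj₂ refl = next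

  scan-sum : ∀ f s j → s + j + f ≡ suc k → s + sum (map len (scan f s j)) ≡ suc k
  scan-sum zero s j e = trans (sym (+-assoc s j 0)) e
  scan-sum (suc f) s j e with isStart (s + j)
  ... | true  = trans (sym (+-assoc s j _)) (scan-sum f (s + j) 1 (budget-split f s j e))
  ... | false = scan-sum f s (suc j) (budget-extend f s j e)

  scan-covers : ∀ f s j → s + j + f ≡ suc k → ∀ v → s ≤ v → v < suc k →
                ∃[ b ] (b ∈ scan f s j × InBlock v b)
  scan-covers zero s j e v s≤v v<n =
    (s , j) , here refl , in-block s≤v (subst (v <_) (sym (trans (sym (+-identityʳ _)) e)) v<n)
  scan-covers (suc f) s j e v s≤v v<n with isStart (s + j)
  ... | false = scan-covers f s (suc j) (budget-extend f s j e) v s≤v v<n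
  ... | true with v <? s + j
  ...   | yes v<s+j = (s , j) , here refl , in-block s≤v v<s+j
  ...   | no v≮s+j with b , b∈ , v∈b ← scan-covers f (s + j) 1 (budget-split f s j e) v (≮⇒≥ v≮s+j) v<n =
    b , there b∈ , v∈b

  scan-starts-≥ : ∀ f s j {b} → b ∈ scan f s j → s ≤ start b
  scan-starts-≥ zero s j (here refl) = ≤-refl
  scan-starts-≥ (suc f) s j b∈ with isStart (s + j)
  scan-starts-≥ (suc f) s j (here refl) | true = ≤-refl
  scan-starts-≥ (suc f) s j (there b∈)  | true = ≤-trans (m≤m+n s j) (scan-starts-≥ f (s + j) 1 b∈)
  scan-starts-≥ (suc f) s j b∈ | false = scan-starts-≥ f s (suc j) b∈

  scan-unique-starts : ∀ f s j → 1 ≤ j → Unique (map start (scan f s j))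
  scan-unique-starts zero s j _ = All.[] ∷ []
  scan-unique-starts (suc f) s j j≥1 with isStart (s + j)
  ... | true  = All.tabulate s-first ∷ scan-unique-starts f (s + j) 1 (s≤s z≤n)
    where
    s-first : ∀ {y} → y ∈ map start (scan f (s + j) 1) → s ≢ y
    s-first y∈ refl with b , b∈ , refl ← ∈-map⁻ start y∈ =
      <-irrefl refl (<-≤-trans (m<m+n s j≥1) (scan-starts-≥ f (s + j) 1 b∈))
  ... | false = scan-unique-starts f s (suc j) (s≤s z≤n)

  scan-length : ∀ f s j → length (scan f s j) ≤ suc f
  scan-length zero s j = s≤s z≤n
  scan-length (suc f) s j with isStart (s + j)
  ... | true  = s≤s (scan-length f (s + j) 1)
  ... | false = m≤n⇒m≤1+n (scan-length f s (suc j))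

  -- If the next value is not a start it joins the current run, saving one block.
  scan-merge-length : ∀ f s j → isStart (s + j) ≡ false → length (scan (suc f) s j) ≤ suc f
  scan-merge-length f s j next rewrite next = scan-length f s (suc j)

  -- The canonical structure: the maximal runs of 0, …, n-1.
  C : List Block
  C = scan k 0 1

  C-runs : ∀ {b} → b ∈ C → IsRun b
  C-runs = scan-runs k 0 1 (s≤s z≤n) refl (singleton-no-interior 0) refl

  C-unique-starts : Unique (map start C)
  C-unique-starts = scan-unique-starts k 0 1 (s≤s z≤n)

  C-structure : IsConsecStructure σ C
  C-structure = (λ _ b∈ → IsRun.nonempty (C-runs b∈))
              , (λ _ b∈ → IsRun.bounded (C-runs b∈))
              , scan-sum k 0 1 refl
              , (λ v v<n → scan-covers k 0 1 refl v z≤n v<n)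
              , (λ b b∈ t t< → nonStart⇒linked-at (start b) t (IsRun.noStartWithin (C-runs b∈) t t<))

  -- Lengths sum to n ≥ 1, so every structure has a block.
  structure-nonempty : ∀ {bs} → IsConsecStructure σ bs → 1 ≤ length bs
  structure-nonempty {[]} (_ , _ , () , _ , _)
  structure-nonempty {_ ∷ _} _ = s≤s z≤n

  -- In any structure, consecutive members of a block are linked, so no start is inside a block …
  block-no-start-within : ∀ {bs} → IsConsecStructure σ bs →
                          ∀ {b} → b ∈ bs → NoStartWithin (start b) (len b)
  block-no-start-within (_ , _ , _ , _ , linked) {b} b∈ t t< =
    linked⇒nonStart-at (start b) t (linked b b∈ t t<)

  start-not-inside : ∀ {bs} → IsConsecStructure σ bs → ∀ {b v} → b ∈ bs →
                     start b < v → v < start b + len b → isStart v ≡ true → ⊥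
  start-not-inside st {b} b∈ s<v v<end v-start with t , t< , refl ← interior-offset s<v v<end =
    true-and-false v-start (block-no-start-within st b∈ t t<)

  -- … and therefore every start is the first value of one of its blocks.
  start-is-block-start : ∀ {bs} → IsConsecStructure σ bs →
                         ∀ {v} → v < suc k → isStart v ≡ true → v ∈ map start bs
  start-is-block-start st@(_ , _ , _ , covers , _) {v} v<n v-start with covers v v<n
  ... | (s , j) , b∈ , zero , _ , refl =
    subst (_∈ map start _) (sym (+-identityʳ s)) (∈-map⁺ start b∈)
  ... | (s , j) , b∈ , suc t , t< , refl =
    ⊥-elim (true-and-false v-start (block-no-start-within st b∈ t t<))

  C-starts-⊆ : ∀ {bs} → IsConsecStructure σ bs → map start C ⊆ map start bs
  C-starts-⊆ st v∈ with b , b∈ , refl ← ∈-map⁻ start v∈ =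
    start-is-block-start st (<-≤-trans (m<m+n (start b) (IsRun.nonempty r)) (IsRun.bounded r)) (IsRun.atStart r)
    where r = C-runs b∈

  -- C has one block per start, so it has as few blocks as any structure.
  C-minimal : ∀ bs → IsConsecStructure σ bs → length C ≤ length bs
  C-minimal bs st = subst₂ _≤_ (length-map start C) (length-map start bs)
                           (unique-⊆-length C-unique-starts (C-starts-⊆ st))

  -- In a structure whose blocks begin at distinct starts, each block ends at n or
  -- just before a start: otherwise the block holding the next value would overlap it.
  block-ends-at-start : ∀ {bs} → IsConsecStructure σ bs → Unique (map start bs) →
                        (∀ {b} → b ∈ bs → isStart (start b) ≡ true) →
                        ∀ {b} → b ∈ bs → start b + len b < suc k → isStart (start b + len b) ≡ true
  block-ends-at-start st@(nonempty , _ , _ , covers , _) distinct starts {s , j} b∈ end<n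
    with covers (s + j) end<n
  ... | (s₂ , j₂) , b₂∈ , zero , _ , end≡ =
    subst (λ v → isStart v ≡ true) (sym (trans end≡ (+-identityʳ s₂))) (starts b₂∈)
  ... | (s₂ , j₂) , b₂∈ , suc u , u+1<j₂ , end≡ with <-cmp s s₂
  ...   | tri< s<s₂ _ _ =
    ⊥-elim (start-not-inside st b∈ s<s₂ (subst (s₂ <_) (sym end≡) (m<m+n s₂ (s≤s z≤n))) (starts b₂∈))
  ...   | tri> _ _ s₂<s =
    ⊥-elim (start-not-inside st b₂∈ s₂<s
      (<-trans (subst (s <_) end≡ (m<m+n s (nonempty _ b∈))) (+-monoʳ-< s₂ u+1<j₂)) (starts b∈))
  ...   | tri≈ _ refl _ with refl ← unique-map-injective start distinct b∈ b₂∈ refl =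
    ⊥-elim (<-irrefl (sym (+-cancelˡ-≡ s j (suc u) end≡)) u+1<j₂)

  blocks-are-runs : ∀ {bs} → IsConsecStructure σ bs → Unique (map start bs) →
                    (∀ {b} → b ∈ bs → isStart (start b) ≡ true) → ∀ {b} → b ∈ bs → IsRun b
  blocks-are-runs st@(nonempty , bounded , _ , _ , _) distinct starts {b} b∈ =
    run (nonempty b b∈) (starts b∈) (block-no-start-within st b∈) (bounded b b∈) ends
    where
    ends : start b + len b ≡ suc k ⊎ isStart (start b + len b) ≡ true
    ends with m≤n⇒m<n∨m≡n (bounded b b∈)
    ... | inj₁ end<n = inj₂ (block-ends-at-start st distinct starts b∈ end<n)
    ... | inj₂ end≡n = inj₁ end≡n

  -- A minimal structure has exactly the starts as block starts, so its blocks are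
  -- the maximal runs and it is a rearrangement of C.
  standard-is-C : ∀ bs → IsStandardStructure σ bs → bs ↭ C
  standard-is-C bs (st , minimal) = unique-⊆-↭ (Unique.map⁻ C-unique-starts) C⊆bs (minimal C C-structure)
    where
    starts↭ : map start bs ↭ map start C
    starts↭ = unique-⊆-↭ C-unique-starts (C-starts-⊆ st)
                (subst₂ _≤_ (sym (length-map start bs)) (sym (length-map start C)) (minimal C C-structure))
    bs-starts : ∀ {b} → b ∈ bs → isStart (start b) ≡ true
    bs-starts b∈ with b′ , b′∈ , e ← ∈-map⁻ start (∈-resp-↭ starts↭ (∈-map⁺ start b∈)) =
      subst (λ v → isStart v ≡ true) (sym e) (IsRun.atStart (C-runs b′∈))
    bs-runs : ∀ {b} → b ∈ bs → IsRun b
    bs-runs = blocks-are-runs st (unique-resp-↭ (↭-sym starts↭) C-unique-starts) bs-starts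
    C⊆bs : C ⊆ bs
    C⊆bs {s , j} b∈ with ∈-map⁻ start (C-starts-⊆ st (∈-map⁺ start b∈))
    ... | (_ , j′) , b′∈ , refl with run-length-unique (C-runs b∈) (bs-runs b′∈)
    ...   | refl = b′∈

mainTheorem4 : ∀ (k : ℕ) → 1 ≤ k → (σ : Permutation′ (suc k)) → IsNCycle σ →
    ∃[ bs ] (IsStandardStructure σ bs × 1 ≤ length bs × length bs ≤ k
    × (∀ bs′ → IsStandardStructure σ bs′ → bs′ ↭ bs))
mainTheorem4 zero () σ cycle
mainTheorem4 (suc k) _ σ cycle =
  C , (C-structure , C-minimal) , structure-nonempty C-structure , at-most-k-blocks , standard-is-C
  where
  open Canonical (suc k) σ
  -- 1 is not a start, so 0 and 1 share the first block.
  at-most-k-blocks : length C ≤ suc k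
  at-most-k-blocks = scan-merge-length k 0 1 (linked⇒nonStart 0 (one-right-of-zero σ cycle))
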